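{- Let $G$ be a convex bipartite graph satisfying Property B. If $G$ is monotone, then $|X|-1\le |Y|\le |X|+1$.
   Context: All graphs are finite, simple, connected and unweighted. A convex bipartite graph is a bipartite graph $G$ with bipartition $(X,Y)$ together with an ordering $X=(x_1,\ldots,x_n)$ such that for every $y\in Y$ the neighborhood $N_G(y)$ consists of consecutive vertices of this ordering; $n=|X|$. For $1\le p<q\le n$ let $X_{p..q}=\{x_p,\ldots,x_q\}$, $N_G[X_{p..q}]=\{y\in Y : N_G(y)\subseteq X_{p..q}\}$ and $N'_G[X_{p..q}]=\{y\in Y : |N_G(y)\cap X_{p..q}|\ge 2\}$. A vertex is pendant if it has degree $1$. $G$ satisfies Property B if: (1) for all $1\le p<q\le n$ with $(p,q)\ne(1,n)$, $|N_G[X_{p..q}]|\le q-p+1$, and $|N_G[X_{1..n}]|\le n+1$; (2) for every integer $j\in\{1,\ldots,n-1\}$ and all indices with $1\le p_1<q_1\le p_2<q_2\le\cdots\le p_j<q_j\le n$, $\left|\bigcup_{i=1}^j N'_G[X_{p_i..q_i}]\right|\ge\sum_{i=1}^j (q_i-p_i)$; (3) $G$ has at most $2$ pendant vertices, and if $n\ge 2$ no $x\in X$ is adjacent to two pendant vertices of $Y$. A set $X_{p..q}$ ($1\le p<q\le n$) is maximal if $|N_G[X_{p..q}]|=q-p+1$ and there is no $X_{p'..q'}$ with $|N_G[X_{p'..q'}]|=q'-p'+1$ and either $1<p'<p<q\le q'<n$ or $1<p'\le p<q<q'<n$. $G$ is monotone if it satisfies Property B, no pendant vertex $y\in Y$ is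 adjacent to some $x_k$ with $1<k<n$, and there is no maximal set $X_{p..q}$ with $1<p<q<n$. -}

module Defs where

open import Data.Bool using (Bool; true; false; T; _∧_; _∨_; not)
open import Data.Nat using (ℕ; zero; suc; _+_; _∸_; _≤_; _<_; _≤ᵇ_)
open import Data.Fin using (Fin; toℕ)
open import Data.Fin.Subset using (Subset; ∣_∣; ⋃)
open import Data.Vec using (tabulate)
open import Data.List using (List; []; _∷_; map; length)
open import Data.Nat.ListAction using (sum)
open import Data.Product using (_×_; _,_; proj₁; proj₂; ∃; ∃-syntax; Σ)
open import Data.Sum using (_⊎_; inj₁; inj₂)
open import Data.Empty using (⊥)
open import Relation.Nullary using (¬_)
open import Relation.Binary.PropositionalEquality using (_≡_; _≢_)
open import Relation.Binary.Construct.Closure.ReflexiveTransitive using (Star)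

-- Conventions: X = Fin n, ordered by toℕ; x_i (paper, 1-based) is the element
-- with toℕ = i - 1.  Y = Fin m.  adj y x = true iff y and x are adjacent.
-- Intervals X_{p..q} are given by 0-based natural-number bounds p ≤ toℕ x ≤ q.

cnt : ∀ {k} → (Fin k → Bool) → ℕ
cnt f = ∣ tabulate f ∣

inRange : ℕ → ℕ → ℕ → Bool
inRange p q i = (p ≤ᵇ i) ∧ (i ≤ᵇ q)

Vertex : ℕ → ℕ → Set
Vertex n m = Fin n ⊎ Fin m

Edge : ∀ {n m} → (Fin m → Fin n → Bool) → Vertex n m → Vertex n m → Set
Edge adj (inj₁ x) (inj₁ x') = ⊥
Edge adj (inj₁ x) (inj₂ y)  = T (adj y x)
Edge adj (inj₂ y) (inj₁ x)  = T (adj y x)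
Edge adj (inj₂ y) (inj₂ y') = ⊥

record ConvexBipartite (n m : ℕ) : Set where
  field
    adj       : Fin m → Fin n → Bool
    convex    : ∀ (y : Fin m) (i j k : Fin n) →
                toℕ i ≤ toℕ k → toℕ k ≤ toℕ j →
                T (adj y i) → T (adj y j) → T (adj y k)
    connected : ∀ (u v : Vertex n m) → Star (Edge adj) u v

module _ {n m : ℕ} (G : ConvexBipartite n m) where
  open ConvexBipartite G

  degY : Fin m → ℕ
  degY y = cnt (λ x → adj y x)

  degX : Fin n → ℕ
  degX x = cnt (λ y → adj y x)

  PendantY : Fin m → Set
  PendantY y = degY y ≡ 1

  pendantCount : ℕ
  pendantCount = cnt (λ x → degX x Data.Nat.≡ᵇ 1) + cnt (λ y → degY y Data.Nat.≡ᵇ 1)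

  -- N_G[X_{p..q}] = { y : N(y) ⊆ X_{p..q} }  (0-based bounds)
  closedN : ℕ → ℕ → Subset m
  closedN p q = tabulate (λ y → allX (λ x → not (adj y x) ∨ inRange p q (toℕ x)))
    where
      allX : (Fin n → Bool) → Bool
      allX f = cnt (λ x → not (f x)) Data.Nat.≡ᵇ 0

  openN : ℕ → ℕ → Subset m
  openN p q = tabulate (λ y → 2 ≤ᵇ cnt (λ x → adj y x ∧ inRange p q (toℕ x)))

  data Chain : List (ℕ × ℕ) → Set where
    one  : ∀ {p q} → p < q → suc q ≤ n → Chain ((p , q) ∷ [])
    cons : ∀ {p q p' q' rest} → p < q → q ≤ p' →
           Chain ((p' , q') ∷ rest) → Chain ((p , q) ∷ (p' , q') ∷ rest)

  record PropertyB : Set where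
    field
      closed-bound : ∀ (p q : ℕ) → p < q → suc q ≤ n →
                     ¬ (p ≡ 0 × suc q ≡ n) →
                     ∣ closedN p q ∣ ≤ suc (q ∸ p)
      closed-whole : ∣ closedN 0 (n ∸ 1) ∣ ≤ n + 1
      open-bound   : ∀ (I : List (ℕ × ℕ)) →
                     1 ≤ length I → length I ≤ n ∸ 1 → Chain I →
                     sum (map (λ pq → proj₂ pq ∸ proj₁ pq) I)
                       ≤ ∣ ⋃ (map (λ pq → openN (proj₁ pq) (proj₂ pq)) I) ∣
      few-pendants : pendantCount ≤ 2
      no-double    : 2 ≤ n → ∀ (x : Fin n) (y₁ y₂ : Fin m) → y₁ ≢ y₂ →
                     PendantY y₁ → PendantY y₂ →
                     T (adj y₁ x) → T (adj y₂ x) → ⊥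

  Tight : ℕ → ℕ → Set
  Tight p q = ∣ closedN p q ∣ ≡ suc (q ∸ p)

  -- X_{p..q} is maximal (0-based: paper's 1 < p' becomes 0 < p', q' < n becomes suc q' < n)
  Maximal : ℕ → ℕ → Set
  Maximal p q = p < q × suc q ≤ n × Tight p q ×
    (¬ (∃[ p' ] ∃[ q' ] (p' < q' × suc q' ≤ n × Tight p' q' ×
        ((0 < p' × p' < p × q ≤ q' × suc q' < n)
         ⊎ (0 < p' × p' ≤ p × q < q' × suc q' < n)))))

  record Monotone : Set where
    field
      propB          : PropertyB
      pendant-ends   : ∀ (y : Fin m) (x : Fin n) → PendantY y → T (adj y x) →
                       0 < toℕ x → suc (toℕ x) < n → ⊥
      no-inner-max   : ∀ (p q : ℕ) → 0 < p → p < q → suc q < n → ¬ Maximal p q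

module Submission where

-- Both inequalities follow from Property B alone.
--
-- * |Y| ≤ |X| + 1.  Every y ∈ Y has its neighbourhood inside the whole of X,
--   so N_G[X_{1..n}] = Y, and condition (1) for (p,q) = (1,n) bounds |Y|.
-- * |X| ≤ |Y| + 1.  Condition (2) applied to a single interval X_{p..q} says
--   |N'_G[X_{p..q}]| ≥ q - p.  For n ≥ 2 take the whole interval X_{1..n}:
--   then n - 1 ≤ |N'_G[X_{1..n}]| ≤ |Y|.

open import Defs
open import Data.Nat using (ℕ; zero; suc; _+_; _∸_; _≤_; _<_; _≡ᵇ_; s≤s; z≤n)
open import Data.Nat.Properties
  using (≤-refl; ≤-trans; +-comm; +-identityʳ; m≤n+m; ≤⇒≤ᵇ; <⇒≤pred; module ≤-Reasoning)
open import Data.Product using (_×_; _,_)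
open import Data.Bool using (Bool; true; false; not; _∨_)
open import Data.Bool.Properties using (∨-zeroʳ; T-≡)
open import Data.Fin using (Fin; toℕ)
open import Data.Fin.Properties using (toℕ≤pred[n])
open import Data.Fin.Subset using (∣_∣; ⊤; ⋃)
open import Data.Fin.Subset.Properties using (∣p∣≤n; ∣⊤∣≡n; ∣⊥∣≡0; ∪-identityʳ)
open import Data.Vec using (tabulate; replicate)
open import Data.Vec.Properties using (tabulate-cong; tabulate-∘; map-const)
open import Data.List using ([]; _∷_)
open import Function using (const; id)
open import Function.Bundles using (Equivalence)
open import Relation.Binary.PropositionalEquality using (_≡_; sym; trans; cong; module ≡-Reasoning)

tabulate-const : ∀ {a} {A : Set a} {k : ℕ} (b : A) → tabulate {n = k} (const b) ≡ replicate k b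
tabulate-const {k = k} b = trans (tabulate-∘ (const b) id) (map-const (tabulate {n = k} id) b)

tabulate-everywhere : ∀ {k} (f : Fin k → Bool) → (∀ i → f i ≡ true) → tabulate f ≡ ⊤
tabulate-everywhere f holds = trans (tabulate-cong holds) (tabulate-const true)

cnt-nowhere : ∀ {k} (f : Fin k → Bool) → (∀ i → f i ≡ false) → cnt f ≡ 0
cnt-nowhere {k} f fails =
  trans (cong ∣_∣ (trans (tabulate-cong fails) (tabulate-const false))) (∣⊥∣≡0 k)

inRange-whole : ∀ {n} (x : Fin n) → inRange 0 (n ∸ 1) (toℕ x) ≡ true
inRange-whole {suc n} x = Equivalence.to T-≡ (≤⇒≤ᵇ (toℕ≤pred[n] x))

module _ {n m : ℕ} (G : ConvexBipartite n m) where
  open ConvexBipartite G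

  closedN-whole : closedN G 0 (n ∸ 1) ≡ ⊤
  closedN-whole = tabulate-everywhere _ (λ y → cong (_≡ᵇ 0) (cnt-nowhere _ (no-escape y)))
    where
      no-escape : ∀ y x → not (not (adj y x) ∨ inRange 0 (n ∸ 1) (toℕ x)) ≡ false
      no-escape y x = cong not (begin
        not (adj y x) ∨ inRange 0 (n ∸ 1) (toℕ x)  ≡⟨ cong (not (adj y x) ∨_) (inRange-whole x) ⟩
        not (adj y x) ∨ true                       ≡⟨ ∨-zeroʳ (not (adj y x)) ⟩
        true                                       ∎)
        where open ≡-Reasoning

  module _ (propB : PropertyB G) where
    open PropertyB propB

    openN-single : ∀ {p q} → p < q → suc q ≤ n → q ∸ p ≤ ∣ openN G p q ∣
    openN-single {p} {q} p<q q<n = begin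
      q ∸ p                                   ≡⟨ sym (+-identityʳ (q ∸ p)) ⟩
      q ∸ p + 0                               ≤⟨ open-bound ((p , q) ∷ []) (s≤s z≤n) one≤n∸1 (one p<q q<n) ⟩
      ∣ ⋃ (openN G p q ∷ []) ∣                 ≡⟨ cong ∣_∣ (∪-identityʳ (openN G p q)) ⟩
      ∣ openN G p q ∣                         ∎
      where
        open ≤-Reasoning
        one≤n∸1 : 1 ≤ n ∸ 1
        one≤n∸1 = ≤-trans (≤-trans (s≤s z≤n) p<q) (<⇒≤pred q<n)

    Y-bound : m ≤ n + 1
    Y-bound = begin
      m                           ≡⟨ sym (∣⊤∣≡n m) ⟩
      ∣ ⊤ {m} ∣                     ≡⟨ cong ∣_∣ (sym closedN-whole) ⟩
      ∣ closedN G 0 (n ∸ 1) ∣       ≤⟨ closed-whole ⟩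
      n + 1                       ∎
      where open ≤-Reasoning

X-bound : ∀ {n m} (G : ConvexBipartite n m) → PropertyB G → n ≤ m + 1
X-bound {zero}        _ _ = z≤n
X-bound {suc zero}    {m} _ _ = m≤n+m 1 m
X-bound {suc (suc k)} {m} G propB = begin
  suc (suc k)              ≤⟨ s≤s (openN-single G propB (s≤s z≤n) ≤-refl) ⟩
  suc ∣ openN G 0 (suc k) ∣  ≤⟨ s≤s (∣p∣≤n (openN G 0 (suc k))) ⟩
  suc m                    ≡⟨ +-comm 1 m ⟩
  m + 1                    ∎
  where open ≤-Reasoning

lemma8 : ∀ {n m : ℕ} (G : ConvexBipartite n m) →
    PropertyB G → Monotone G → (n ≤ m + 1 × m ≤ n + 1)
lemma8 G propB _ = X-bound G propB , Y-bound G propB
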